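{- Let $(\Gamma,<_1,\dots,<_n)$ be the generic $n$-dimensional permutation structure, and let $<$ be a linear order on $\Gamma$ definable without parameters. Then there is $i\in\{1,\dots,n\}$ such that $<\,=\,<_i$ or $<$ is the reverse of $<_i$.
   Context: An $n$-dimensional permutation structure is a set with $n$ linear orders. The generic $n$-dimensional permutation structure is the Fraïssé limit of the class of all finite $n$-dimensional permutation structures (the unique countable homogeneous such structure into which every finite one embeds). -}

module Defs where

open import Data.Nat using (ℕ)
open import Data.Fin using (Fin; zero; suc)
open import Data.Product using (Σ; _×_; _,_; ∃)
open import Data.Sum using (_⊎_)
open import Data.Empty using (⊥)
open import Data.Unit using (⊤)
open import Function using (_↔_; _⇔_; Injective)
open import Relation.Binary using (Rel; IsStrictTotalOrder)
open import Relation.Binary.PropositionalEquality using (_≡_)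
open import Relation.Nullary using (¬_)

record PermStr (n : ℕ) : Set₁ where
  field
    Carrier : Set
    _<[_]_  : Carrier → Fin n → Carrier → Set
    isSTO   : (i : Fin n) → IsStrictTotalOrder _≡_ (λ x y → x <[ i ] y)

record FinPermStr (n : ℕ) : Set₁ where
  field
    size : ℕ
    rel  : Fin n → Fin size → Fin size → Set
    isSTO : (i : Fin n) → IsStrictTotalOrder _≡_ (rel i)

module _ {n : ℕ} (M : PermStr n) where
  open PermStr M

  IsEmbedding : (A : FinPermStr n) → (Fin (FinPermStr.size A) → Carrier) → Set
  IsEmbedding A f = Injective _≡_ _≡_ f
    × (∀ i a b → FinPermStr.rel A i a b ⇔ (f a <[ i ] f b))

  IsAutomorphism : (Carrier ↔ Carrier) → Set
  IsAutomorphism σ = ∀ i x y → x <[ i ] y ⇔ (Function.Inverse.to σ x <[ i ] Function.Inverse.to σ y)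

  Countable : Set
  Countable = Σ (ℕ → Carrier) λ e → ∀ x → ∃ λ m → e m ≡ x

  -- homogeneity: every isomorphism between finite substructures (given as
  -- injective enumerations a, b of the same length with the same order-type)
  -- extends to an automorphism
  Homogeneous : Set
  Homogeneous = ∀ (k : ℕ) (a b : Fin k → Carrier) →
    Injective _≡_ _≡_ a → Injective _≡_ _≡_ b →
    (∀ i j l → a j <[ i ] a l ⇔ b j <[ i ] b l) →
    Σ (Carrier ↔ Carrier) λ σ → IsAutomorphism σ × (∀ j → Function.Inverse.to σ (a j) ≡ b j)

  Universal : Set₁
  Universal = ∀ (A : FinPermStr n) → Σ (Fin (FinPermStr.size A) → Carrier) (IsEmbedding A)

  -- M is (isomorphic to) the Fraïssé limit of all finite n-dim permutation
  -- structures: countable, homogeneous, and its age is the whole class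
  IsGeneric : Set₁
  IsGeneric = Countable × Homogeneous × Universal

-- First-order formulas in the language {<_1,...,<_n} (with equality), with
-- free variables indexed by Fin m (de Bruijn style), no parameters.
data Formula (n : ℕ) : ℕ → Set where
  lt    : ∀ {m} → Fin n → Fin m → Fin m → Formula n m
  eq    : ∀ {m} → Fin m → Fin m → Formula n m
  false : ∀ {m} → Formula n m
  _∧'_  : ∀ {m} → Formula n m → Formula n m → Formula n m
  _∨'_  : ∀ {m} → Formula n m → Formula n m → Formula n m
  _⇒'_  : ∀ {m} → Formula n m → Formula n m → Formula n m
  all'  : ∀ {m} → Formula n (ℕ.suc m) → Formula n m
  ex'   : ∀ {m} → Formula n (ℕ.suc m) → Formula n m

extend : ∀ {m} {A : Set} → A → (Fin m → A) → Fin (ℕ.suc m) → A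
extend a ρ zero    = a
extend a ρ (suc j) = ρ j

⟦_⟧ : ∀ {n m} → Formula n m → (M : PermStr n) → (Fin m → PermStr.Carrier M) → Set
⟦ lt i a b ⟧ M ρ = PermStr._<[_]_ M (ρ a) i (ρ b)
⟦ eq a b ⟧   M ρ = ρ a ≡ ρ b
⟦ false ⟧    M ρ = ⊥
⟦ φ ∧' ψ ⟧   M ρ = ⟦ φ ⟧ M ρ × ⟦ ψ ⟧ M ρ
⟦ φ ∨' ψ ⟧   M ρ = ⟦ φ ⟧ M ρ ⊎ ⟦ ψ ⟧ M ρ
⟦ φ ⇒' ψ ⟧   M ρ = ⟦ φ ⟧ M ρ → ⟦ ψ ⟧ M ρ
⟦ all' φ ⟧   M ρ = ∀ x → ⟦ φ ⟧ M (extend x ρ)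
⟦ ex' φ ⟧    M ρ = Σ (PermStr.Carrier M) λ x → ⟦ φ ⟧ M (extend x ρ)

-- the binary relation defined by a formula with two free variables
-- (variable 0 is x, variable 1 is y)
pair : {A : Set} → A → A → Fin 2 → A
pair x y zero = x
pair x y (suc _) = y

Defined : ∀ {n} (M : PermStr n) → Formula n 2 → PermStr.Carrier M → PermStr.Carrier M → Set
Defined M φ x y = ⟦ φ ⟧ M (pair x y)

IsLinearOrder : {A : Set} → (A → A → Set) → Set
IsLinearOrder {A} R = (∀ x → ¬ R x x)
  × (∀ x y z → R x y → R y z → R x z)
  × (∀ x y → ¬ x ≡ y → R x y ⊎ R y x)

module Submission where

-- The type of a pair x ≠ y is the sign vector v ∈ Boolⁿ recording, for each i,
-- whether x <ᵢ y or y <ᵢ x.  The proof has three ingredients.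
--  * Invariance: formulas are preserved by automorphisms, so by homogeneity
--    whether φ(x,y) holds depends only on the type of (x,y).
--  * Realisation: by universality every type is realised, and so is every
--    triple of types (s, t, v) for (x,y), (y,z), (x,z) in which v agrees with s
--    wherever s and t agree (these are the triples that occur in some finite
--    structure on three points).
--  * Combinatorics: the set of types of φ-related pairs contains exactly one
--    of v and its opposite (φ is total and asymmetric) and is convex, i.e.
--    closed under "lying between" two members (φ is transitive).  Every such
--    family of sign vectors consists of all v with v i = b for a fixed i, b.
-- The last family is precisely the type set of <ᵢ (b = true) or of its
-- reverse (b = false), which proves the theorem.

open import Defs
open import Data.Nat using (ℕ; _<_; z<s; s<s)
open import Data.Nat.Properties using (<-trans; <-cmp)
open import Data.Fin using (Fin; zero; suc)
open import Data.Fin.Properties using (_≟_)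
open import Data.Bool using (Bool; true; false; not; if_then_else_)
open import Data.Bool.Properties using (not-¬)
open import Data.List using (List; []; _∷_; [_]; allFin)
open import Data.List.Relation.Unary.Any using (here; there)
open import Data.List.Membership.Propositional using (_∈_; _∉_)
open import Data.List.Membership.Propositional.Properties using (∈-allFin)
import Data.List.Membership.DecPropositional as DecMembership
open import Data.Product using (Σ; _×_; _,_; proj₁; proj₂)
open import Data.Product.Function.NonDependent.Propositional using (_×-⇔_)
open import Data.Sum using (_⊎_; inj₁; inj₂; [_,_]′)
open import Data.Sum.Function.Propositional using (_⊎-⇔_)
open import Data.Empty using (⊥; ⊥-elim)
open import Function using (_⇔_; _↔_; Injective; id)
open import Function.Bundles using (Equivalence; Inverse; Injection; mk⇔)
open import Function.Construct.Identity using (⇔-id)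
open import Function.Properties.Inverse using (↔⇒↣)
open import Function.Related.TypeIsomorphisms using (→-cong-⇔)
open import Relation.Binary using (IsStrictTotalOrder; isStrictTotalOrderᶜ; tri<; tri≈; tri>)
open import Relation.Binary.Definitions using (Trichotomous; Asymmetric; Irreflexive)
open import Relation.Binary.PropositionalEquality using (_≡_; refl; sym; trans; cong; subst; isEquivalence; module ≡-Reasoning)
open import Relation.Nullary using (¬_; yes; no; does)

module Invariance {n : ℕ} (M : PermStr n)
                  (σ : PermStr.Carrier M ↔ PermStr.Carrier M)
                  (aut : IsAutomorphism M σ) where
  open PermStr M
  open Inverse σ

  _↦_ : ∀ {m} → (Fin m → Carrier) → (Fin m → Carrier) → Set
  ρ ↦ ρ′ = ∀ j → ρ′ j ≡ to (ρ j)

  extend-↦ : ∀ {m} {ρ ρ′ : Fin m → Carrier} {x x′} →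
             ρ ↦ ρ′ → x′ ≡ to x → extend x ρ ↦ extend x′ ρ′
  extend-↦ ρ↦ρ′ x↦x′ zero    = x↦x′
  extend-↦ ρ↦ρ′ x↦x′ (suc j) = ρ↦ρ′ j

  -- Quantifiers are handled by letting σ act on the bound variable: σ is onto
  -- for the forward direction of ∀ (and backward of ∃) via `from`.
  invariant : ∀ {m} (ψ : Formula n m) {ρ ρ′ : Fin m → Carrier} →
              ρ ↦ ρ′ → ⟦ ψ ⟧ M ρ ⇔ ⟦ ψ ⟧ M ρ′
  invariant (lt i a b) {ρ} ρ↦ρ′ rewrite ρ↦ρ′ a | ρ↦ρ′ b = aut i (ρ a) (ρ b)
  invariant (eq a b) ρ↦ρ′ rewrite ρ↦ρ′ a | ρ↦ρ′ b =
    mk⇔ (cong to) (Injection.injective (↔⇒↣ σ))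
  invariant false    ρ↦ρ′ = ⇔-id ⊥
  invariant (ψ ∧' χ) ρ↦ρ′ = invariant ψ ρ↦ρ′ ×-⇔ invariant χ ρ↦ρ′
  invariant (ψ ∨' χ) ρ↦ρ′ = invariant ψ ρ↦ρ′ ⊎-⇔ invariant χ ρ↦ρ′
  invariant (ψ ⇒' χ) ρ↦ρ′ = →-cong-⇔ (invariant ψ ρ↦ρ′) (invariant χ ρ↦ρ′)
  invariant (all' ψ) ρ↦ρ′ = mk⇔
    (λ h x′ → Equivalence.to (invariant ψ (extend-↦ ρ↦ρ′ (sym (strictlyInverseˡ x′))))
                             (h (from x′)))
    (λ h x → Equivalence.from (invariant ψ (extend-↦ ρ↦ρ′ refl)) (h (to x)))
  invariant (ex' ψ) ρ↦ρ′ = mk⇔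
    (λ (x , h) → to x , Equivalence.to (invariant ψ (extend-↦ ρ↦ρ′ refl)) h)
    (λ (x′ , h) → from x′ , Equivalence.from
       (invariant ψ (extend-↦ ρ↦ρ′ (sym (strictlyInverseˡ x′)))) h)

Oriented : {A : Set} → Bool → (A → A → Set) → A → A → Set
Oriented true  R x y = R x y
Oriented false R x y = R y x

module _ {A : Set} {R : A → A → Set} where

  oriented-flip : ∀ b {x y} → Oriented b R x y → Oriented (not b) R y x
  oriented-flip true  r = r
  oriented-flip false r = r

  oriented-irrefl : Irreflexive _≡_ R → ∀ b {x} → ¬ Oriented b R x x
  oriented-irrefl irrefl true  r = irrefl refl r
  oriented-irrefl irrefl false r = irrefl refl r

  oriented-total : Trichotomous _≡_ R → ∀ b {x y} → ¬ x ≡ y →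
                   Oriented b R x y ⊎ Oriented b R y x
  oriented-total compare b {x} {y} x≢y with compare x y
  ... | tri≈ _ x≡y _ = ⊥-elim (x≢y x≡y)
  oriented-total compare true  x≢y | tri< r _ _ = inj₁ r
  oriented-total compare false x≢y | tri< r _ _ = inj₂ r
  oriented-total compare true  x≢y | tri> _ _ r = inj₂ r
  oriented-total compare false x≢y | tri> _ _ r = inj₁ r

  oriented-unique : Asymmetric R → ∀ {a b x y} →
                    Oriented a R x y → Oriented b R x y → a ≡ b
  oriented-unique asym {true}  {true}  r s = refl
  oriented-unique asym {false} {false} r s = refl
  oriented-unique asym {true}  {false} r s = ⊥-elim (asym r s)
  oriented-unique asym {false} {true}  r s = ⊥-elim (asym r s)

  oriented-alike : Asymmetric R → ∀ b {x y x′ y′} →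
                   Oriented b R x y → Oriented b R x′ y′ →
                   (R x y ⇔ R x′ y′) × (R y x ⇔ R y′ x′)
  oriented-alike asym true  r r′ =
    mk⇔ (λ _ → r′) (λ _ → r) , mk⇔ (λ s → ⊥-elim (asym r s)) (λ s → ⊥-elim (asym r′ s))
  oriented-alike asym false r r′ =
    mk⇔ (λ s → ⊥-elim (asym r s)) (λ s → ⊥-elim (asym r′ s)) , mk⇔ (λ _ → r′) (λ _ → r)

oriented-map : {A B : Set} {R : A → A → Set} {Q : B → B → Set} (f : A → B) →
               (∀ p q → R p q ⇔ Q (f p) (f q)) →
               ∀ b {p q} → Oriented b R p q → Oriented b Q (f p) (f q)
oriented-map f R⇔Q true  r = Equivalence.to (R⇔Q _ _) r
oriented-map f R⇔Q false r = Equivalence.to (R⇔Q _ _) r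

rankedOrder : {A : Set} (f : A → ℕ) → Injective _≡_ _≡_ f →
              IsStrictTotalOrder _≡_ (λ p q → f p < f q)
rankedOrder f f-inj = isStrictTotalOrderᶜ record
  { isEquivalence = isEquivalence
  ; trans         = <-trans
  ; compare       = compare
  }
  where
  compare : Trichotomous _≡_ (λ p q → f p < f q)
  compare p q with <-cmp (f p) (f q)
  ... | tri< a ¬b ¬c = tri< a (λ p≡q → ¬b (cong f p≡q)) ¬c
  ... | tri≈ ¬a b ¬c = tri≈ ¬a (f-inj b) ¬c
  ... | tri> ¬a ¬b c = tri> ¬a (λ p≡q → ¬b (cong f p≡q)) c

ranks : ℕ → ℕ → ℕ → Fin 3 → ℕ
ranks a b c zero             = a
ranks a b c (suc zero)       = b
ranks a b c (suc (suc zero)) = c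

ranks-injective : ∀ {a b c} → ¬ a ≡ b → ¬ a ≡ c → ¬ b ≡ c → Injective _≡_ _≡_ (ranks a b c)
ranks-injective a≢b a≢c b≢c {zero}             {zero}             e = refl
ranks-injective a≢b a≢c b≢c {zero}             {suc zero}         e = ⊥-elim (a≢b e)
ranks-injective a≢b a≢c b≢c {zero}             {suc (suc zero)}   e = ⊥-elim (a≢c e)
ranks-injective a≢b a≢c b≢c {suc zero}         {zero}             e = ⊥-elim (a≢b (sym e))
ranks-injective a≢b a≢c b≢c {suc zero}         {suc zero}         e = refl
ranks-injective a≢b a≢c b≢c {suc zero}         {suc (suc zero)}   e = ⊥-elim (b≢c e)
ranks-injective a≢b a≢c b≢c {suc (suc zero)}   {zero}             e = ⊥-elim (a≢c (sym e))
ranks-injective a≢b a≢c b≢c {suc (suc zero)}   {suc zero}         e = ⊥-elim (b≢c (sym e))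
ranks-injective a≢b a≢c b≢c {suc (suc zero)}   {suc (suc zero)}   e = refl

p₀ p₁ p₂ : Fin 3
p₀ = zero
p₁ = suc zero
p₂ = suc (suc zero)

-- Points 0, 1, 2 ranked so that (0,1), (1,2), (0,2) have orientations s, t, v.
tripleRank : Bool → Bool → Bool → Fin 3 → ℕ
tripleRank true  true  _     = ranks 0 1 2
tripleRank false false _     = ranks 2 1 0
tripleRank true  false true  = ranks 0 2 1
tripleRank true  false false = ranks 1 2 0
tripleRank false true  true  = ranks 1 0 2
tripleRank false true  false = ranks 2 0 1

tripleRank-injective : ∀ s t v → Injective _≡_ _≡_ (tripleRank s t v)
tripleRank-injective true  true  _     = ranks-injective (λ ()) (λ ()) (λ ())
tripleRank-injective false false _     = ranks-injective (λ ()) (λ ()) (λ ())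
tripleRank-injective true  false true  = ranks-injective (λ ()) (λ ()) (λ ())
tripleRank-injective true  false false = ranks-injective (λ ()) (λ ()) (λ ())
tripleRank-injective false true  true  = ranks-injective (λ ()) (λ ()) (λ ())
tripleRank-injective false true  false = ranks-injective (λ ()) (λ ()) (λ ())

RankOrder : (Fin 3 → ℕ) → Fin 3 → Fin 3 → Set
RankOrder r p q = r p < r q

tripleRank-realizes : ∀ s t v → (s ≡ t → v ≡ s) →
  let R = RankOrder (tripleRank s t v) in
  Oriented s R p₀ p₁ × Oriented t R p₁ p₂ × Oriented v R p₀ p₂
tripleRank-realizes true  true  true  _ = z<s , s<s z<s , z<s
tripleRank-realizes false false false _ = s<s z<s , z<s , z<s
tripleRank-realizes true  true  false c with c refl
... | ()
tripleRank-realizes false false true  c with c refl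
... | ()
tripleRank-realizes true  false true  _ = z<s , s<s z<s , z<s
tripleRank-realizes true  false false _ = s<s z<s , z<s , z<s
tripleRank-realizes false true  true  _ = z<s , z<s , s<s z<s
tripleRank-realizes false true  false _ = z<s , z<s , s<s z<s

-- Self-dual convex families of sign vectors are dictators.

Signs : ℕ → Set
Signs n = Fin n → Bool

opposite : ∀ {n} → Signs n → Signs n
opposite v j = not (v j)

Between : ∀ {n} → Signs n → Signs n → Signs n → Set
Between s t v = ∀ j → s j ≡ t j → v j ≡ s j

module SelfDualConvex {n : ℕ} (S : Signs n → Set)
  (oneSide : ∀ v → S v ⊎ S (opposite v))
  (notBoth : ∀ v → S v → S (opposite v) → ⊥)
  (convex  : ∀ {s t v} → S s → S t → Between s t v → S v) where

  Dictator : Set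
  Dictator = Σ (Fin n) λ i → Σ Bool λ b → ∀ u → u i ≡ b → S u

  -- Starting from a member s₀, shrink the set of coordinates on which agreeing
  -- with s₀ is known to suffice for membership, one coordinate at a time; the
  -- empty set is impossible, so some step must produce a dictator.
  module FromMember (s₀ : Signs n) (S₀ : S s₀) where
    open DecMembership (_≟_ {n}) using (_∈?_)

    Suffices : List (Fin n) → Set
    Suffices ks = ∀ u → (∀ {j} → j ∈ ks → u j ≡ s₀ j) → S u

    keepOn : List (Fin n) → Signs n
    keepOn ks j = if does (j ∈? ks) then s₀ j else not (s₀ j)

    keepOn-∈ : ∀ {ks j} → j ∈ ks → keepOn ks j ≡ s₀ j
    keepOn-∈ {ks} {j} j∈ks with j ∈? ks
    ... | yes _    = refl
    ... | no  j∉ks = ⊥-elim (j∉ks j∈ks)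

    keepOn-∉ : ∀ {ks j} → j ∉ ks → keepOn ks j ≡ not (s₀ j)
    keepOn-∉ {ks} {j} j∉ks with j ∈? ks
    ... | yes j∈ks = ⊥-elim (j∉ks j∈ks)
    ... | no  _    = refl

    suffices-all : Suffices (allFin n)
    suffices-all u agree = convex S₀ S₀ (λ j _ → agree (∈-allFin j))

    suffices-none : ¬ Suffices []
    suffices-none suff = notBoth s₀ (suff s₀ λ ()) (suff (opposite s₀) λ ())

    -- Let u agree with s₀ exactly at k.  If u ∈ S, everything with the sign of
    -- s₀ at k lies between s₀ and u.  Otherwise its opposite is in S, and
    -- everything agreeing with s₀ on ks lies between keepOn (k ∷ ks) and it.
    shrink : ∀ k ks → Suffices (k ∷ ks) → Dictator ⊎ Suffices ks
    shrink k ks suff with oneSide (keepOn [ k ])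
    ... | inj₁ Su = inj₁ (k , s₀ k , λ v vk → convex S₀ Su (between-s₀-u v vk))
      where
      between-s₀-u : ∀ v → v k ≡ s₀ k → Between s₀ (keepOn [ k ]) v
      between-s₀-u v vk j e with j ∈? [ k ]
      ... | yes (here j≡k) = subst (λ i → v i ≡ s₀ i) (sym j≡k) vk
      ... | no j∉[k] = ⊥-elim (not-¬ refl (trans e (keepOn-∉ {[ k ]} j∉[k])))
    ... | inj₂ Sū = inj₂ λ v agree →
        convex (suff (keepOn (k ∷ ks)) keepOn-∈) Sū (between-kept-ū v agree)
      where
      between-kept-ū : ∀ v → (∀ {j} → j ∈ ks → v j ≡ s₀ j) →
                       Between (keepOn (k ∷ ks)) (opposite (keepOn [ k ])) v
      between-kept-ū v agree j e with j ∈? (k ∷ ks)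
      ... | yes (there j∈ks) = trans (agree j∈ks) (sym (keepOn-∈ {k ∷ ks} (there j∈ks)))
      ... | yes (here j≡k) = ⊥-elim (not-¬ refl (begin
            s₀ j                  ≡⟨ keepOn-∈ {k ∷ ks} (here j≡k) ⟨
            keepOn (k ∷ ks) j     ≡⟨ e ⟩
            not (keepOn [ k ] j)  ≡⟨ cong not (keepOn-∈ {[ k ]} (here j≡k)) ⟩
            not (s₀ j)            ∎))
        where open ≡-Reasoning
      ... | no j∉k∷ks = ⊥-elim (not-¬ refl (begin
            not (s₀ j)            ≡⟨ keepOn-∉ {k ∷ ks} j∉k∷ks ⟨
            keepOn (k ∷ ks) j     ≡⟨ e ⟩
            not (keepOn [ k ] j)  ≡⟨ cong not (keepOn-∉ {[ k ]} j∉[k]) ⟩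
            not (not (s₀ j))      ∎))
        where
        open ≡-Reasoning
        j∉[k] : j ∉ [ k ]
        j∉[k] (here j≡k) = j∉k∷ks (here j≡k)

    dictatorFrom : ∀ ks → Suffices ks → Dictator
    dictatorFrom []       suff = ⊥-elim (suffices-none suff)
    dictatorFrom (k ∷ ks) suff = [ id , dictatorFrom ks ]′ (shrink k ks suff)

  dictator : Dictator
  dictator = [ fromMember , fromMember ]′ (oneSide (λ _ → true))
    where
    fromMember : ∀ {s₀} → S s₀ → Dictator
    fromMember S₀ = FromMember.dictatorFrom _ S₀ (allFin n) (FromMember.suffices-all _ S₀)

pair-injective : {A : Set} {x y : A} → ¬ x ≡ y → Injective _≡_ _≡_ (pair x y)
pair-injective x≢y {zero}     {zero}     _ = refl
pair-injective x≢y {zero}     {suc zero} e = ⊥-elim (x≢y e)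
pair-injective x≢y {suc zero} {zero}     e = ⊥-elim (x≢y (sym e))
pair-injective x≢y {suc zero} {suc zero} _ = refl

module Generic {n : ℕ} (Γ : PermStr n) (gen : IsGeneric Γ) where
  open PermStr Γ
  module Order (i : Fin n) = IsStrictTotalOrder (isSTO i)

  Ordered : Bool → Fin n → Carrier → Carrier → Set
  Ordered b i = Oriented b (λ x y → x <[ i ] y)

  record HasType (x y : Carrier) (v : Signs n) : Set where
    constructor typed
    field
      distinct : ¬ x ≡ y
      ordered  : ∀ i → Ordered (v i) i x y

  hasType-swap : ∀ {x y v} → HasType x y v → HasType y x (opposite v)
  hasType-swap {v = v} (typed x≢y ord) =
    typed (λ y≡x → x≢y (sym y≡x)) (λ i → oriented-flip (v i) (ord i))

  orientation : ∀ i {x y} → ¬ x ≡ y → Σ Bool λ b → Ordered b i x y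
  orientation i x≢y = [ (true ,_) , (false ,_) ]′ (oriented-total (Order.compare i) true x≢y)

  typeOf : ∀ {x y} → ¬ x ≡ y → Σ (Signs n) (HasType x y)
  typeOf x≢y = (λ i → proj₁ (orientation i x≢y)) , typed x≢y (λ i → proj₂ (orientation i x≢y))

  typeDetermines : ∀ (ψ : Formula n 2) {x y x′ y′ v} →
                   HasType x y v → HasType x′ y′ v → Defined Γ ψ x y → Defined Γ ψ x′ y′
  typeDetermines ψ {x} {y} {x′} {y′} {v} (typed x≢y ord) (typed x′≢y′ ord′) with
    proj₁ (proj₂ gen) 2 (pair x y) (pair x′ y′) (pair-injective x≢y) (pair-injective x′≢y′)
                      sameOrders
    where
    irreflexive : ∀ {i u w} → u <[ i ] u ⇔ w <[ i ] w
    irreflexive {i} = mk⇔ (λ r → ⊥-elim (Order.irrefl i refl r))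
                          (λ r → ⊥-elim (Order.irrefl i refl r))
    sameOrders : ∀ i j l → pair x y j <[ i ] pair x y l ⇔ pair x′ y′ j <[ i ] pair x′ y′ l
    sameOrders i zero       zero       = irreflexive
    sameOrders i zero       (suc zero) = proj₁ (oriented-alike (Order.asym i) (v i) (ord i) (ord′ i))
    sameOrders i (suc zero) zero       = proj₂ (oriented-alike (Order.asym i) (v i) (ord i) (ord′ i))
    sameOrders i (suc zero) (suc zero) = irreflexive
  ... | σ , aut , σ-pair = Equivalence.to (Invariance.invariant Γ σ aut ψ (λ j → sym (σ-pair j)))

  realizeTriple : ∀ s t v → Between s t v →
    Σ Carrier λ x → Σ Carrier λ y → Σ Carrier λ z → HasType x y s × HasType y z t × HasType x z v
  realizeTriple s t v btw with proj₂ (proj₂ gen) triangle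
    where
    triangle : FinPermStr n
    triangle = record
      { size  = 3
      ; rel   = λ j → RankOrder (tripleRank (s j) (t j) (v j))
      ; isSTO = λ j → rankedOrder _ (tripleRank-injective (s j) (t j) (v j)) }
  ... | f , f-inj , f-iso =
      f p₀ , f p₁ , f p₂
      , typed (λ e → 0≢1 (f-inj e)) (λ j → realized j (s j) (proj₁ (realizes j)))
      , typed (λ e → 1≢2 (f-inj e)) (λ j → realized j (t j) (proj₁ (proj₂ (realizes j))))
      , typed (λ e → 0≢2 (f-inj e)) (λ j → realized j (v j) (proj₂ (proj₂ (realizes j))))
    where
    0≢1 : ¬ p₀ ≡ p₁
    0≢1 ()
    1≢2 : ¬ p₁ ≡ p₂
    1≢2 ()
    0≢2 : ¬ p₀ ≡ p₂
    0≢2 ()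
    realizes : ∀ j → let R = RankOrder (tripleRank (s j) (t j) (v j)) in
               Oriented (s j) R p₀ p₁ × Oriented (t j) R p₁ p₂ × Oriented (v j) R p₀ p₂
    realizes j = tripleRank-realizes (s j) (t j) (v j) (btw j)
    realized : ∀ j b {p q} → Oriented b (RankOrder (tripleRank (s j) (t j) (v j))) p q →
               Ordered b j (f p) (f q)
    realized j = oriented-map f (f-iso j)

  realizePair : ∀ v → Σ Carrier λ x → Σ Carrier λ y → HasType x y v
  realizePair v with realizeTriple v v v (λ _ _ → refl)
  ... | x , y , _ , xy , _ = x , y , xy

-- A definable linear order induces a self-dual convex family of types.

module DefinableOrder {n : ℕ} (Γ : PermStr n) (gen : IsGeneric Γ)
                      (φ : Formula n 2) (lin : IsLinearOrder (Defined Γ φ)) where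
  open PermStr Γ
  open Generic Γ gen

  Φ : Carrier → Carrier → Set
  Φ = Defined Γ φ

  Φ-irrefl : ∀ x → ¬ Φ x x
  Φ-irrefl = proj₁ lin

  Φ-trans : ∀ x y z → Φ x y → Φ y z → Φ x z
  Φ-trans = proj₁ (proj₂ lin)

  Φ-total : ∀ x y → ¬ x ≡ y → Φ x y ⊎ Φ y x
  Φ-total = proj₂ (proj₂ lin)

  Φ-asym : ∀ {x y} → Φ x y → Φ y x → ⊥
  Φ-asym {x} {y} xy yx = Φ-irrefl x (Φ-trans x y x xy yx)

  Holds : Signs n → Set
  Holds v = ∀ x y → HasType x y v → Φ x y

  holds-by-example : ∀ {x y v} → HasType x y v → Φ x y → Holds v
  holds-by-example xy Φxy x′ y′ x′y′ = typeDetermines φ xy x′y′ Φxy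

  oneSide : ∀ v → Holds v ⊎ Holds (opposite v)
  oneSide v with realizePair v
  ... | x , y , xy with Φ-total x y (HasType.distinct xy)
  ...   | inj₁ Φxy = inj₁ (holds-by-example xy Φxy)
  ...   | inj₂ Φyx = inj₂ (holds-by-example (hasType-swap xy) Φyx)

  notBoth : ∀ v → Holds v → Holds (opposite v) → ⊥
  notBoth v Hv Hv̄ with realizePair v
  ... | x , y , xy = Φ-asym (Hv x y xy) (Hv̄ y x (hasType-swap xy))

  convex : ∀ {s t v} → Holds s → Holds t → Between s t v → Holds v
  convex {s} {t} {v} Hs Ht btw with realizeTriple s t v btw
  ... | x , y , z , xy , yz , xz = holds-by-example xz (Φ-trans x y z (Hs x y xy) (Ht y z yz))

  open SelfDualConvex Holds oneSide notBoth convex using (Dictator)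

  ordered⇒Φ : ∀ i b → (∀ u → u i ≡ b → Holds u) → ∀ {x y} → Ordered b i x y → Φ x y
  ordered⇒Φ i b G {x} {y} r with typeOf x≢y
    where
    x≢y : ¬ x ≡ y
    x≢y refl = oriented-irrefl (Order.irrefl i) b r
  ... | v , xy = G v (oriented-unique (Order.asym i) (HasType.ordered xy i) r) x y xy

  coordinateOrder : ∀ i b → (∀ u → u i ≡ b → Holds u) → ∀ x y → Φ x y ⇔ Ordered b i x y
  coordinateOrder i b G x y = mk⇔ forward (ordered⇒Φ i b G)
    where
    forward : Φ x y → Ordered b i x y
    forward Φxy with oriented-total (Order.compare i) b (λ { refl → Φ-irrefl x Φxy })
    ... | inj₁ r = r
    ... | inj₂ r = ⊥-elim (Φ-asym Φxy (ordered⇒Φ i b G r))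

  orderFromDictator : Dictator → Σ (Fin n) λ i →
      (∀ x y → Φ x y ⇔ x <[ i ] y) ⊎ (∀ x y → Φ x y ⇔ y <[ i ] x)
  orderFromDictator (i , true  , G) = i , inj₁ (coordinateOrder i true G)
  orderFromDictator (i , false , G) = i , inj₂ (coordinateOrder i false G)

mainTheorem18 : (n : ℕ) (Γ : PermStr n) → IsGeneric Γ →
    (φ : Formula n 2) → IsLinearOrder (Defined Γ φ) →
    Σ (Fin n) λ i →
    (∀ x y → Defined Γ φ x y ⇔ PermStr._<[_]_ Γ x i y)
    ⊎ (∀ x y → Defined Γ φ x y ⇔ PermStr._<[_]_ Γ y i x)
mainTheorem18 n Γ gen φ lin =
  orderFromDictator (SelfDualConvex.dictator Holds oneSide notBoth convex)
  where open DefinableOrder Γ gen φ lin
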